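{- Let $v,w\in \Sigma^+$ be strings such that $w$ is a Lyndon word. If $v \prec w$, then $v^\infty \prec w$.
   Context: $\Sigma$ is a totally ordered alphabet; $\prec$ is the lexicographic order on $\Sigma^*\cup\Sigma^\infty$ (finite and infinite strings), in which a proper prefix is smaller. $v^\infty$ is the infinite string $vvv\cdots$. A Lyndon word is a non-empty string strictly smaller than each of its proper non-empty suffixes. -}

module Defs where

open import Level using (Level; _⊔_)
open import Data.Nat using (ℕ; zero; suc; _<_; _%_; NonZero)
open import Data.List using (List; []; _∷_; length)
open import Data.Maybe using (Maybe; just; nothing)
open import Data.Product using (Σ; _×_; ∃-syntax)
open import Data.Empty using (⊥)
open import Data.Unit using (⊤)
open import Relation.Binary.PropositionalEquality using (_≡_)
open import Relation.Binary.Bundles using (StrictTotalOrder)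

module Strings {a ℓ₁ ℓ₂ : Level} (Σ' : StrictTotalOrder a ℓ₁ ℓ₂) where
  open StrictTotalOrder Σ' using () renaming (Carrier to A; _<_ to _<Σ_)

  -- A string over A, finite or infinite, is represented by its sequence of
  -- positions: position i holds  just c  if the string has length > i,
  -- and  nothing  otherwise (end of string).
  Str : Set a
  Str = ℕ → Maybe A

  _<ₘ_ : Maybe A → Maybe A → Set ℓ₂
  nothing <ₘ nothing = Level.Lift ℓ₂ ⊥
  nothing <ₘ just _  = Level.Lift ℓ₂ ⊤
  just _  <ₘ nothing = Level.Lift ℓ₂ ⊥
  just x  <ₘ just y  = x <Σ y

  -- lexicographic order on finite and infinite strings (proper prefix is smaller)
  _≺_ : Str → Str → Set (a ⊔ ℓ₂)
  x ≺ y = ∃[ i ] ((∀ j → j < i → x j ≡ y j) × (x i <ₘ y i))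

  fin : List A → Str
  fin []       _       = nothing
  fin (c ∷ _)  zero    = just c
  fin (_ ∷ cs) (suc i) = fin cs i

  infPow : (v : List A) → .{{NonZero (length v)}} → Str
  infPow v i = fin v (i % length v)

  drop' : ℕ → List A → List A
  drop' zero    xs       = xs
  drop' (suc n) []       = []
  drop' (suc n) (_ ∷ xs) = drop' n xs

  IsLyndon : List A → Set (a ⊔ ℓ₂)
  IsLyndon w = NonZero (length w) ×
    (∀ k → 0 < k → k < length w → fin w ≺ fin (drop' k w))

-- Let i be the first position where v and w differ.  If i < |v|, then v^∞
-- coincides with v up to and including position i, so the same position
-- witnesses v^∞ ≺ w.  Otherwise v is a proper prefix of w, so n = |v| is a
-- proper suffix offset of w and the Lyndon property gives w ≺ w[n..].  The
-- heart of the argument is then a statement about arbitrary sequences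
-- (periodic-≺): an n-periodic sequence x that agrees with y on its first
-- period lies below y whenever y lies below its own shift by n.  Indeed, if
-- t is where y and its shift first differ, periodicity propagates the
-- agreement of x and y to all positions below n + t (periodic-agreement), and
-- at n + t we get x (n + t) = x t = y t < y (n + t).
module Submission where

open import Defs
open import Level using (Level)
open import Data.Nat using (NonZero)
open import Data.List using (List; length)
open import Relation.Binary.Bundles using (StrictTotalOrder)

open import Data.Nat using (ℕ; zero; suc; _+_; _∸_; _%_; _<_; _≤_; z≤n; s≤s; _<?_; >-nonZero⁻¹)
open import Data.Nat.Properties
  using (≮⇒≥; m+[n∸m]≡n; m<n+m; m≤n+m; n<1+n; m<1+n⇒m≤n; <-≤-trans; ≤-<-trans; <-trans;
         +-cancelˡ-<; +-comm)
open import Data.Nat.DivMod using (m<n⇒m%n≡m; [m+n]%n≡m%n)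
open import Data.Nat.Induction using (<-rec)
open import Data.List using ([]; _∷_)
open import Data.Maybe using (Maybe; just; nothing)
open import Data.Product using (∃; _,_)
open import Relation.Nullary using (yes; no)
open import Relation.Binary.PropositionalEquality
  using (_≡_; refl; sym; trans; cong; subst; module ≡-Reasoning)

module Sequences {b : Level} {B : Set b} where

  AgreeBelow : ℕ → (ℕ → B) → (ℕ → B) → Set b
  AgreeBelow k x y = ∀ j → j < k → x j ≡ y j

  shift : ℕ → (ℕ → B) → ℕ → B
  shift n y j = y (n + j)

  -- If x has period n > 0, agrees with y on its first period, and y agrees
  -- with its n-shift below t, then x and y agree below n + t: each position
  -- j ≥ n reduces to j ∸ n via the periodicity of x and the shift of y.
  periodic-agreement : ∀ {n t} (x y : ℕ → B) → 0 < n →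
    (∀ j → x (n + j) ≡ x j) → AgreeBelow n x y → AgreeBelow t y (shift n y) →
    AgreeBelow (n + t) x y
  periodic-agreement {n} {t} x y 0<n period firstPeriod shifted = <-rec P step
    where
    P : ℕ → Set b
    P j = j < n + t → x j ≡ y j

    step : ∀ j → (∀ {k} → k < j → P k) → P j
    step j ih j<n+t with j <? n
    ... | yes j<n = firstPeriod j j<n
    ... | no j≮n = begin
        x j          ≡⟨ cong x (sym n+j′≡j) ⟩
        x (n + j′)   ≡⟨ period j′ ⟩
        x j′         ≡⟨ ih j′<j (<-≤-trans j′<t (m≤n+m t n)) ⟩
        y j′         ≡⟨ shifted j′ j′<t ⟩
        y (n + j′)   ≡⟨ cong y n+j′≡j ⟩
        y j          ∎
      where
      open ≡-Reasoning
      j′ = j ∸ n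
      n+j′≡j : n + j′ ≡ j
      n+j′≡j = m+[n∸m]≡n (≮⇒≥ j≮n)
      j′<t : j′ < t
      j′<t = +-cancelˡ-< n j′ t (subst (_< n + t) (sym n+j′≡j) j<n+t)
      j′<j : j′ < j
      j′<j = subst (j′ <_) n+j′≡j (m<n+m j′ 0<n)

module Proof {a ℓ₁ ℓ₂ : Level} (Σ' : StrictTotalOrder a ℓ₁ ℓ₂) where
  open Strings Σ'
  open Sequences

  A : Set a
  A = StrictTotalOrder.Carrier Σ'

  <ₘ-above-is-letter : ∀ {m m′ : Maybe A} → m <ₘ m′ → ∃ λ c → m′ ≡ just c
  <ₘ-above-is-letter {m′ = just c} _ = c , refl
  <ₘ-above-is-letter {nothing} {nothing} (Level.lift ())
  <ₘ-above-is-letter {just _}  {nothing} (Level.lift ())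

  ≺-by-agreement : ∀ {x x′ y : Str} i → AgreeBelow (suc i) x′ x →
    AgreeBelow i x y → x i <ₘ y i → x′ ≺ y
  ≺-by-agreement {x} {x′} {y} i x′≈x x≈y x<y =
    i , (λ j j<i → trans (x′≈x j (<-trans j<i (n<1+n i))) (x≈y j j<i))
      , subst (_<ₘ y i) (sym (x′≈x i (n<1+n i))) x<y

  ≺-respʳ : ∀ {x y y′ : Str} → (∀ j → y j ≡ y′ j) → x ≺ y → x ≺ y′
  ≺-respʳ {x} y≡y′ (i , x≈y , x<y) =
    i , (λ j j<i → trans (x≈y j j<i) (y≡y′ j)) , subst (x i <ₘ_) (y≡y′ i) x<y

  periodic-≺ : ∀ {n} (x y : Str) → 0 < n → (∀ j → x (n + j) ≡ x j) →
    AgreeBelow n x y → y ≺ shift n y → x ≺ y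
  periodic-≺ {n} x y 0<n period firstPeriod (t , shifted , y<shift) =
    n + t , agree , subst (_<ₘ y (n + t)) (sym x[n+t]≡y[t]) y<shift
    where
    agree : AgreeBelow (n + t) x y
    agree = periodic-agreement x y 0<n period firstPeriod shifted
    x[n+t]≡y[t] : x (n + t) ≡ y t
    x[n+t]≡y[t] = trans (period t) (agree t (m<n+m t 0<n))

  fin-beyond : (v : List A) → ∀ j → length v ≤ j → fin v j ≡ nothing
  fin-beyond []      j       _       = refl
  fin-beyond (c ∷ v) (suc j) (s≤s p) = fin-beyond v j p

  fin-within : (v : List A) → ∀ j {c} → fin v j ≡ just c → j < length v
  fin-within []      j       ()
  fin-within (c ∷ v) zero    _ = s≤s z≤n
  fin-within (c ∷ v) (suc j) e = s≤s (fin-within v j e)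

  fin-drop : (w : List A) → ∀ k j → fin (drop' k w) j ≡ fin w (k + j)
  fin-drop w       zero    j = refl
  fin-drop []      (suc k) j = refl
  fin-drop (c ∷ w) (suc k) j = fin-drop w k j

  infPow-prefix : (v : List A) .{{_ : NonZero (length v)}} →
    AgreeBelow (length v) (infPow v) (fin v)
  infPow-prefix v j j<n = cong (fin v) (m<n⇒m%n≡m j<n)

  infPow-period : (v : List A) .{{_ : NonZero (length v)}} →
    ∀ j → infPow v (length v + j) ≡ infPow v j
  infPow-period v j =
    cong (fin v) (trans (cong (_% length v) (+-comm (length v) j)) ([m+n]%n≡m%n j (length v)))

  proper-prefix : (v w : List A) → ∀ i → length v ≤ i → fin v i <ₘ fin w i → i < length w
  proper-prefix v w i |v|≤i v<w
    with <ₘ-above-is-letter {m = nothing} (subst (_<ₘ fin w i) (fin-beyond v i |v|≤i) v<w)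
  ... | _ , w[i]≡c = fin-within w i w[i]≡c

  main : (v w : List A) → .{{_ : NonZero (length v)}} →
    IsLyndon w → fin v ≺ fin w → infPow v ≺ fin w
  main v w (_ , lyndon) (i , v≈w , v<w) with i <? length v
  ... | yes i<n =
    ≺-by-agreement i (λ j j<1+i → infPow-prefix v j (≤-<-trans (m<1+n⇒m≤n j<1+i) i<n)) v≈w v<w
  ... | no i≮n = periodic-≺ (infPow v) (fin w) 0<n (infPow-period v) firstPeriod w<shift
    where
    n≤i : length v ≤ i
    n≤i = ≮⇒≥ i≮n
    0<n : 0 < length v
    0<n = >-nonZero⁻¹ (length v)
    firstPeriod : AgreeBelow (length v) (infPow v) (fin w)
    firstPeriod j j<n = trans (infPow-prefix v j j<n) (v≈w j (<-≤-trans j<n n≤i))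
    w<shift : fin w ≺ shift (length v) (fin w)
    w<shift = ≺-respʳ (fin-drop w (length v))
      (lyndon (length v) 0<n (≤-<-trans n≤i (proper-prefix v w i n≤i v<w)))

fact6 : {a ℓ₁ ℓ₂ : Level} (Σ' : StrictTotalOrder a ℓ₁ ℓ₂) →
    let open Strings Σ' in
    (v w : List (StrictTotalOrder.Carrier Σ')) → .{{_ : NonZero (length v)}} →
    IsLyndon w → fin v ≺ fin w → infPow v ≺ fin w
fact6 Σ' = Proof.main Σ'
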